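{- Let $G$ be a graph, $r\in\mathbb{N}_{>0}$, $\sigma\ge3$ an integer, $I$ an inclusion-wise maximal distance-$r$ independent set in $G$, and $H$ the unweighted $(I,r,\sigma)$-distance graph of $G$. For every $u\in V(G)$ let $\varphi(u)$ be an arbitrary vertex of $I$ with $\mathrm{dist}_G(u,\varphi(u))\le r$. Then for all $u,v\in V(G)$, $$\frac{1}{\sigma r}\mathrm{dist}_G(u,v)-2r\le\mathrm{dist}_H(\varphi(u),\varphi(v))\le\frac{1}{(\sigma-2)r}\cdot\mathrm{dist}_G(u,v)+1.$$
   Context: Graphs are finite, simple, unweighted, with shortest-path distance $\mathrm{dist}$. A distance-$r$ independent set is $I\subseteq V(G)$ with $\mathrm{dist}_G(u,v)>r$ for distinct $u,v\in I$. The unweighted $(I,r,\sigma)$-distance graph of $G$ is the (unweighted) graph with vertex set $I$ in which distinct $u,v\in I$ are adjacent whenever $\mathrm{dist}_G(u,v)\le\sigma r$. -}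

module Defs where

open import Data.Nat using (ℕ; zero; suc; _≤_; _*_)
open import Data.Fin using (Fin)
open import Data.Fin.Subset using (Subset; _∈_; _⊆_)
open import Data.Product using (Σ; ∃; _×_; _,_)
open import Relation.Binary.PropositionalEquality using (_≡_; _≢_)
open import Relation.Nullary using (¬_)

record Graph : Set₁ where
  field
    n      : ℕ
    Adj    : Fin n → Fin n → Set
    sym    : ∀ {u v} → Adj u v → Adj v u
    irrefl : ∀ {u} → ¬ Adj u u
open Graph public

data Walk {A : Set} (R : A → A → Set) : A → A → ℕ → Set where
  []  : ∀ {x} → Walk R x x 0
  _∷_ : ∀ {x y z k} → R x y → Walk R y z k → Walk R x z (suc k)

-- "dist_R(x,y) ≤ k": some walk of length at most k joins x and y
-- (false for every k when x,y are in different components, i.e. dist = ∞).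
DistLe : {A : Set} → (A → A → Set) → A → A → ℕ → Set
DistLe R x y k = ∃ λ m → m ≤ k × Walk R x y m

DistLeG : (G : Graph) → Fin (n G) → Fin (n G) → ℕ → Set
DistLeG G = DistLe (Adj G)

IsDistIndep : (G : Graph) → ℕ → Subset (n G) → Set
IsDistIndep G r I =
  ∀ u v → u ∈ I → v ∈ I → u ≢ v → ¬ DistLeG G u v r

IsMaximalDistIndep : (G : Graph) → ℕ → Subset (n G) → Set
IsMaximalDistIndep G r I =
  IsDistIndep G r I × (∀ J → I ⊆ J → IsDistIndep G r J → J ⊆ I)

VI : (G : Graph) → Subset (n G) → Set
VI G I = Σ (Fin (n G)) (λ v → v ∈ I)

DistGraphAdj : (G : Graph) → (I : Subset (n G)) → (r σ : ℕ) → VI G I → VI G I → Set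
DistGraphAdj G I r σ (u , _) (v , _) = u ≢ v × DistLeG G u v (σ * r)

-- The upper bound on dist_G comes from following the H-path: each H-edge is a
-- G-path of length at most σr, and the endpoints are within r of their anchors.
-- For the bound on dist_H, cut a G-path from u to v into blocks of
-- length k = (σ-2)r and anchor each cut point y at φ(y). Consecutive anchors are
-- joined by a G-path of length at most r + k + r = σr, hence are equal or
-- adjacent in H, and every H-edge so used pays for k edges of the G-path.
module Submission where

open import Defs
open import Data.Nat using (ℕ; suc; _≤_; _<_; _*_; _+_; _∸_; _≤?_; z≤n; s≤s)
open import Data.Nat.Properties hiding (_≟_)
open import Data.Nat.Induction using (<-wellFounded)
open import Data.Nat.Tactic.RingSolver using (solve-∀)
open import Data.Fin using (Fin; _≟_)
open import Data.Fin.Subset using (Subset; _∈_)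
open import Data.Product using (∃; _×_; _,_; proj₁)
open import Data.Vec.Properties.WithK using ([]=-irrelevant)
open import Induction.WellFounded using (Acc; acc)
open import Relation.Binary.Definitions using (Symmetric)
open import Relation.Binary.PropositionalEquality using (_≡_; refl; cong; subst)
open import Relation.Nullary using (yes; no)

module _ {A : Set} {R : A → A → Set} where

  _++ʷ_ : ∀ {x y z a b} → Walk R x y a → Walk R y z b → Walk R x z (a + b)
  []      ++ʷ w′ = w′
  (e ∷ w) ++ʷ w′ = e ∷ (w ++ʷ w′)

  reverseʷ : Symmetric R → ∀ {x y a} → Walk R x y a → Walk R y x a
  reverseʷ R-sym []                 = []
  reverseʷ R-sym (_∷_ {k = a} e w) =
    subst (Walk R _ _) (+-comm a 1) (reverseʷ R-sym w ++ʷ (R-sym e ∷ []))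

  splitAtʷ : ∀ k {x z m} → k ≤ m → Walk R x z m →
             ∃ λ y → Walk R x y k × Walk R y z (m ∸ k)
  splitAtʷ 0       _         w       = _ , [] , w
  splitAtʷ (suc k) (s≤s k≤m) (e ∷ w) =
    let y , w₁ , w₂ = splitAtʷ k k≤m w in y , e ∷ w₁ , w₂

  walk⇒DistLe : ∀ {x y a} → Walk R x y a → DistLe R x y a
  walk⇒DistLe w = _ , ≤-refl , w

  DistLe-mono : ∀ {x y a b} → a ≤ b → DistLe R x y a → DistLe R x y b
  DistLe-mono a≤b (m , m≤a , w) = m , ≤-trans m≤a a≤b , w

  DistLe-sym : Symmetric R → ∀ {x y a} → DistLe R x y a → DistLe R y x a
  DistLe-sym R-sym (m , m≤a , w) = m , m≤a , reverseʷ R-sym w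

  infixl 5 _⨾_
  _⨾_ : ∀ {x y z a b} → DistLe R x y a → DistLe R y z b → DistLe R x z (a + b)
  (m , m≤a , w) ⨾ (m′ , m′≤b , w′) = m + m′ , +-mono-≤ m≤a m′≤b , w ++ʷ w′

r+[σ∸2]r+r≡σr : ∀ r σ → 2 ≤ σ → r + (σ ∸ 2) * r + r ≡ σ * r
r+[σ∸2]r+r≡σr r (suc (suc q)) (s≤s (s≤s _)) = lemma r q
  where
  lemma : ∀ r q → r + q * r + r ≡ suc (suc q) * r
  lemma = solve-∀

r+ec+r≤c[e+2r] : ∀ r c e → 1 ≤ c → r + e * c + r ≤ c * (e + 2 * r)
r+ec+r≤c[e+2r] r c e 1≤c = begin
  r + e * c + r          ≡⟨ lemma r c e ⟩
  c * e + 1 * (2 * r)    ≤⟨ +-monoʳ-≤ (c * e) (*-monoˡ-≤ (2 * r) 1≤c) ⟩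
  c * e + c * (2 * r)    ≡⟨ *-distribˡ-+ c e (2 * r) ⟨
  c * (e + 2 * r)        ∎
  where
  open ≤-Reasoning
  lemma : ∀ r c e → r + e * c + r ≡ c * e + 1 * (2 * r)
  lemma = solve-∀

module DistanceGraph (G : Graph) (I : Subset (n G)) (r σ : ℕ) where

  H : VI G I → VI G I → Set
  H = DistGraphAdj G I r σ

  walkH⇒DistLeG : ∀ {a b e} → Walk H a b e → DistLeG G (proj₁ a) (proj₁ b) (e * (σ * r))
  walkH⇒DistLeG []             = walk⇒DistLe []
  walkH⇒DistLeG ((_ , ab) ∷ w) = ab ⨾ walkH⇒DistLeG w

  DistLeH⇒DistLeG : ∀ {a b e} → DistLe H a b e → DistLeG G (proj₁ a) (proj₁ b) (e * (σ * r))
  DistLeH⇒DistLeG (m , m≤e , w) =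
    DistLe-mono (*-monoˡ-≤ (σ * r) m≤e) (walkH⇒DistLeG w)

  DistLeG⇒DistLeH-1 : ∀ {a b} (a∈ : a ∈ I) (b∈ : b ∈ I) →
                      DistLeG G a b (σ * r) → DistLe H (a , a∈) (b , b∈) 1
  DistLeG⇒DistLeH-1 {a} {b} a∈ b∈ ab with a ≟ b
  ... | yes refl rewrite []=-irrelevant a∈ b∈ = 0 , z≤n , []
  ... | no a≢b = walk⇒DistLe ((a≢b , ab) ∷ [])

  module Anchored
    (φ : Fin (n G) → Fin (n G)) (φ∈ : ∀ u → φ u ∈ I)
    (φ-near : ∀ u → DistLeG G u (φ u) r)
    (k : ℕ) (1≤k : 1 ≤ k) (r+k+r≤σr : r + k + r ≤ σ * r)
    where

    near-φ : ∀ u → DistLeG G (φ u) u r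
    near-φ u = DistLe-sym (Graph.sym G) (φ-near u)

    DistLeG⇒DistLeH : ∀ {a x v d} (a∈ : a ∈ I) → DistLeG G a x r → DistLeG G x v d →
                      ∃ λ e → DistLe H (a , a∈) (φ v , φ∈ v) e × k * e ≤ d + k
    DistLeG⇒DistLeH a∈ ax (m , m≤d , w) =
      let e , ae , ke≤m+k = along (<-wellFounded m) a∈ ax w
      in  e , ae , ≤-trans ke≤m+k (+-monoˡ-≤ k m≤d)
      where
      along : ∀ {a x v m} → Acc _<_ m → (a∈ : a ∈ I) → DistLeG G a x r →
              Walk (Adj G) x v m →
              ∃ λ e → DistLe H (a , a∈) (φ v , φ∈ v) e × k * e ≤ m + k
      along {v = v} {m} (acc rs) a∈ ax w with m ≤? k
      ... | yes m≤k =
        1 , DistLeG⇒DistLeH-1 a∈ (φ∈ v) (DistLe-mono r+m+r≤σr (ax ⨾ walk⇒DistLe w ⨾ φ-near v))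
          , ≤-trans (≤-reflexive (*-identityʳ k)) (m≤n+m k m)
        where
        r+m+r≤σr : r + m + r ≤ σ * r
        r+m+r≤σr = ≤-trans (+-monoˡ-≤ r (+-monoʳ-≤ r m≤k)) r+k+r≤σr
      ... | no m≰k =
        let y , w₁ , w₂    = splitAtʷ k k≤m w
            e , yv , ke≤m = along (rs (∸-monoʳ-< 1≤k k≤m)) (φ∈ y) (near-φ y) w₂
            ay            = DistLe-mono r+k+r≤σr (ax ⨾ walk⇒DistLe w₁ ⨾ φ-near y)
        in  suc e , DistLeG⇒DistLeH-1 a∈ (φ∈ y) ay ⨾ yv , k[1+e]≤m+k e ke≤m
        where
        k≤m : k ≤ m
        k≤m = ≰⇒≥ m≰k
        k[1+e]≤m+k : ∀ e → k * e ≤ m ∸ k + k → k * suc e ≤ m + k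
        k[1+e]≤m+k e ke≤m = begin
          k * suc e        ≡⟨ *-suc k e ⟩
          k + k * e        ≤⟨ +-monoʳ-≤ k ke≤m ⟩
          k + (m ∸ k + k)  ≡⟨ cong (k +_) (m∸n+n≡m k≤m) ⟩
          k + m            ≡⟨ +-comm k m ⟩
          m + k            ∎
          where open ≤-Reasoning

lemma6p1 : (G : Graph) (r σ : ℕ) → 0 < r → 3 ≤ σ →
    (I : Subset (n G)) → IsMaximalDistIndep G r I →
    (φ : Fin (n G) → Fin (n G)) → (φ∈ : ∀ u → φ u ∈ I) →
    (∀ u → DistLeG G u (φ u) r) →
    ∀ u v →
      (∀ e → DistLe (DistGraphAdj G I r σ) (φ u , φ∈ u) (φ v , φ∈ v) e →
         DistLeG G u v (σ * r * (e + 2 * r)))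
      ×
      (∀ d → DistLeG G u v d →
         ∃ λ e → DistLe (DistGraphAdj G I r σ) (φ u , φ∈ u) (φ v , φ∈ v) e
           × (σ ∸ 2) * r * e ≤ d + (σ ∸ 2) * r)
-- Maximality of I is what guarantees that some φ exists.
lemma6p1 G r σ 0<r 3≤σ I _ φ φ∈ φ-near u v = upper , lower
  where
  open DistanceGraph G I r σ
  open Anchored φ φ∈ φ-near ((σ ∸ 2) * r) (*-mono-≤ (∸-monoˡ-≤ 2 3≤σ) 0<r)
         (≤-reflexive (r+[σ∸2]r+r≡σr r σ (≤-trans (n≤1+n 2) 3≤σ)))

  upper : ∀ e → DistLe H (φ u , φ∈ u) (φ v , φ∈ v) e → DistLeG G u v (σ * r * (e + 2 * r))
  upper e h = DistLe-mono (r+ec+r≤c[e+2r] r (σ * r) e 1≤σr)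
                          (φ-near u ⨾ DistLeH⇒DistLeG h ⨾ near-φ v)
    where
    1≤σr : 1 ≤ σ * r
    1≤σr = *-mono-≤ (≤-trans (s≤s z≤n) 3≤σ) 0<r

  lower : ∀ d → DistLeG G u v d →
          ∃ λ e → DistLe H (φ u , φ∈ u) (φ v , φ∈ v) e × (σ ∸ 2) * r * e ≤ d + (σ ∸ 2) * r
  lower _ = DistLeG⇒DistLeH (φ∈ u) (near-φ u)
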